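{- There is, for each finite type $\sigma$, an $\mathsf{HA}^\omega$-formula $E_\sigma(x)$ (with free variable $x:\sigma$) and an $\mathsf{HA}^\omega$-formula $Q_\sigma(x,y)$ (with free variables $x,y:\sigma$) such that, letting $\varphi^I$ denote the result of replacing in a formula $\varphi$ of the language of $\mathsf{HE}\text{ - }\mathsf{HA}^\omega$ every atomic subformula $\mathrm{Ext}_\sigma(t)$ by $E_\sigma(t)$ and every $s=_\sigma t$ by $Q_\sigma(s,t)$ (so that $\varphi^I=\varphi$ for $\mathsf{HA}^\omega$-formulas $\varphi$), we have: $\mathsf{HE}\text{ - }\mathsf{HA}^\omega\vdash\varphi$ implies $\mathsf{HA}^\omega\vdash\varphi^I$. Consequently $\mathsf{HE}\text{ - }\mathsf{HA}^\omega$ is a conservative extension of $\mathsf{HA}^\omega$.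
   Context: Finite types are generated by: $0$ is a type; if $\sigma,\tau$ are types, so are $\sigma\times\tau$ and $\sigma\to\tau$. $\mathsf{HA}^\omega$ is the many-sorted intuitionistic first-order theory whose sorts are the finite types. Its terms are built from variables and, for all types $\rho,\sigma,\tau$, the constants $\mathsf{k}:\rho\to\sigma\to\rho$, $\mathsf{s}:(\rho\to\sigma\to\tau)\to(\rho\to\sigma)\to(\rho\to\tau)$, $\mathsf{pair}:\sigma\to\tau\to\sigma\times\tau$, $\mathsf{fst}:\sigma\times\tau\to\sigma$, $\mathsf{snd}:\sigma\times\tau\to\tau$, $0:0$, $S:0\to0$, $\mathsf{R}:\sigma\to(0\to\sigma\to\sigma)\to0\to\sigma$, by application (associating to the left). Atomic formulas are $\bot$ and $s\equiv_\sigma t$. Axioms: $\equiv_\sigma$ is an equivalence relation; $x\equiv x'\to y\equiv y'\to xy\equiv x'y'$; $\mathsf{k}xy\equiv x$; $\mathsf{s}xyz\equiv xz(yz)$; $\mathsf{fst}(\mathsf{pair}\,xy)\equiv x$; $\mathsf{snd}(\mathsf{pair}\,xy)\equiv y$; $\mathsf{R}xy0\equiv x$; $\mathsf{R}xy(Sm)\equiv ym(\mathsf{R}xym)$; $Sx\equiv_0Sy\to x\equiv_0y$; $\neg(Sx\equiv_00)$; induction for all formulas. Surjective pairing is not assumed. $\mathsf{H}\text{ - }\mathsf{HA}^\omega$ extends the language of $\mathsf{HA}^\omega$ with, for each type $\sigma$, a unary predicate $\mathrm{Ext}_\sigma$ and a binary predicate $=_\sigma$; $\forall^{\mathrm{Ext}}x:\sigma.\psi$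 abbreviates $\forall x:\sigma(\mathrm{Ext}_\sigma(x)\to\psi)$. Its axioms are those of $\mathsf{HA}^\omega$, induction for all formulas of the extended language, and for all $\sigma,\tau$: $x=_0y\leftrightarrow x\equiv_0y$; $\forall x:0\,\mathrm{Ext}_0(x)$; $x=_{\sigma\times\tau}y\leftrightarrow(\mathsf{fst}\,x=_\sigma\mathsf{fst}\,y\wedge\mathsf{snd}\,x=_\tau\mathsf{snd}\,y)$; $\mathrm{Ext}_{\sigma\times\tau}(x)\leftrightarrow(\mathrm{Ext}_\sigma(\mathsf{fst}\,x)\wedge\mathrm{Ext}_\tau(\mathsf{snd}\,x))$; $f=_{\sigma\to\tau}g\leftrightarrow\forall^{\mathrm{Ext}}x:\sigma.fx=_\tau gx$; $\mathrm{Ext}_{\sigma\to\tau}(f)\to\mathrm{Ext}_\sigma(x)\to\mathrm{Ext}_\tau(fx)$; $x\equiv_\sigma y\to\mathrm{Ext}_\sigma(x)\to\mathrm{Ext}_\sigma(y)$; $\mathrm{Ext}(c)$ for each constant $c$. $\mathsf{HE}\text{ - }\mathsf{HA}^\omega$ is $\mathsf{H}\text{ - }\mathsf{HA}^\omega$ plus, for all $\sigma,\tau$, the axiom $\mathrm{Ext}_{\sigma\to\tau}(f)\to\mathrm{Ext}_\sigma(x)\to\mathrm{Ext}_\sigma(y)\to x=_\sigma y\to fx=_\tau fy$. -}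

module Defs where

open import Data.List using (List; []; _∷_; map)
open import Data.List.Membership.Propositional using (_∈_)
open import Data.Product using (_×_)
open import Data.Sum using (_⊎_)

infixr 6 _⊗_
infixr 5 _⇒_

data Ty : Set where
  ι   : Ty
  _⊗_ : Ty → Ty → Ty
  _⇒_ : Ty → Ty → Ty

Ctx : Set
Ctx = List Ty

data Var : Ctx → Ty → Set where
  vz : ∀ {Γ σ} → Var (σ ∷ Γ) σ
  vs : ∀ {Γ σ τ} → Var Γ σ → Var (τ ∷ Γ) σ

data Const : Ty → Set where
  kc    : ∀ ρ σ → Const (ρ ⇒ σ ⇒ ρ)
  sc    : ∀ ρ σ τ → Const ((ρ ⇒ σ ⇒ τ) ⇒ (ρ ⇒ σ) ⇒ (ρ ⇒ τ))
  pairc : ∀ σ τ → Const (σ ⇒ τ ⇒ σ ⊗ τ)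
  fstc  : ∀ σ τ → Const (σ ⊗ τ ⇒ σ)
  sndc  : ∀ σ τ → Const (σ ⊗ τ ⇒ τ)
  zeroc : Const ι
  succc : Const (ι ⇒ ι)
  recc  : ∀ σ → Const (σ ⇒ (ι ⇒ σ ⇒ σ) ⇒ ι ⇒ σ)

infixl 9 _·_

data Tm (Γ : Ctx) : Ty → Set where
  var : ∀ {σ} → Var Γ σ → Tm Γ σ
  con : ∀ {σ} → Const σ → Tm Γ σ
  _·_ : ∀ {σ τ} → Tm Γ (σ ⇒ τ) → Tm Γ σ → Tm Γ τ

Ren : Ctx → Ctx → Set
Ren Γ Δ = ∀ {σ} → Var Γ σ → Var Δ σ

liftR : ∀ {Γ Δ τ} → Ren Γ Δ → Ren (τ ∷ Γ) (τ ∷ Δ)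
liftR r vz     = vz
liftR r (vs v) = vs (r v)

renT : ∀ {Γ Δ σ} → Ren Γ Δ → Tm Γ σ → Tm Δ σ
renT r (var v) = var (r v)
renT r (con c) = con c
renT r (t · u) = renT r t · renT r u

wkT : ∀ {Γ σ τ} → Tm Γ σ → Tm (τ ∷ Γ) σ
wkT = renT vs

Sub : Ctx → Ctx → Set
Sub Γ Δ = ∀ {σ} → Var Γ σ → Tm Δ σ

liftS : ∀ {Γ Δ τ} → Sub Γ Δ → Sub (τ ∷ Γ) (τ ∷ Δ)
liftS s vz     = var vz
liftS s (vs v) = wkT (s v)

subT : ∀ {Γ Δ σ} → Sub Γ Δ → Tm Γ σ → Tm Δ σ
subT s (var v) = s v
subT s (con c) = con c
subT s (t · u) = subT s t · subT s u

𝕜 : ∀ {Γ ρ σ} → Tm Γ (ρ ⇒ σ ⇒ ρ)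
𝕜 = con (kc _ _)
𝕤 : ∀ {Γ ρ σ τ} → Tm Γ ((ρ ⇒ σ ⇒ τ) ⇒ (ρ ⇒ σ) ⇒ (ρ ⇒ τ))
𝕤 = con (sc _ _ _)
pair : ∀ {Γ σ τ} → Tm Γ (σ ⇒ τ ⇒ σ ⊗ τ)
pair = con (pairc _ _)
fst : ∀ {Γ σ τ} → Tm Γ (σ ⊗ τ ⇒ σ)
fst = con (fstc _ _)
snd : ∀ {Γ σ τ} → Tm Γ (σ ⊗ τ ⇒ τ)
snd = con (sndc _ _)
𝟘 : ∀ {Γ} → Tm Γ ι
𝟘 = con zeroc
𝕊 : ∀ {Γ} → Tm Γ ι → Tm Γ ι
𝕊 t = con succc · t
ℝ : ∀ {Γ σ} → Tm Γ (σ ⇒ (ι ⇒ σ ⇒ σ) ⇒ ι ⇒ σ)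
ℝ = con (recc _)

-- Formulas.  'base' = language of HA^ω, 'ext' = language of
-- H-HA^ω / HE-HA^ω (additional atoms Ext_σ and =_σ).

data Lang : Set where
  base ext : Lang

infixr 4 _⊃_
infix  3 _⇔'_
infixr 5 _∨'_
infixr 6 _∧'_
infix  7 _≡'_ _=ₑ_

data Form : Lang → Ctx → Set where
  ⊥'    : ∀ {L Γ} → Form L Γ
  _≡'_  : ∀ {L Γ σ} → Tm Γ σ → Tm Γ σ → Form L Γ
  Ext   : ∀ {Γ σ} → Tm Γ σ → Form ext Γ
  _=ₑ_  : ∀ {Γ σ} → Tm Γ σ → Tm Γ σ → Form ext Γ
  _∧'_  : ∀ {L Γ} → Form L Γ → Form L Γ → Form L Γ
  _∨'_  : ∀ {L Γ} → Form L Γ → Form L Γ → Form L Γ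
  _⊃_   : ∀ {L Γ} → Form L Γ → Form L Γ → Form L Γ
  ∀'    : ∀ {L Γ} σ → Form L (σ ∷ Γ) → Form L Γ
  ∃'    : ∀ {L Γ} σ → Form L (σ ∷ Γ) → Form L Γ

¬' : ∀ {L Γ} → Form L Γ → Form L Γ
¬' φ = φ ⊃ ⊥'

_⇔'_ : ∀ {L Γ} → Form L Γ → Form L Γ → Form L Γ
φ ⇔' ψ = (φ ⊃ ψ) ∧' (ψ ⊃ φ)

subF : ∀ {L Γ Δ} → Sub Γ Δ → Form L Γ → Form L Δ
subF s ⊥'       = ⊥'
subF s (t ≡' u) = subT s t ≡' subT s u
subF s (Ext t)  = Ext (subT s t)
subF s (t =ₑ u) = subT s t =ₑ subT s u
subF s (φ ∧' ψ) = subF s φ ∧' subF s ψ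
subF s (φ ∨' ψ) = subF s φ ∨' subF s ψ
subF s (φ ⊃ ψ)  = subF s φ ⊃ subF s ψ
subF s (∀' σ φ) = ∀' σ (subF (liftS s) φ)
subF s (∃' σ φ) = ∃' σ (subF (liftS s) φ)

wkF : ∀ {L Γ τ} → Form L Γ → Form L (τ ∷ Γ)
wkF = subF (λ v → var (vs v))

sub0 : ∀ {Γ σ} → Tm Γ σ → Sub (σ ∷ Γ) Γ
sub0 t vz     = t
sub0 t (vs v) = var v

_[_] : ∀ {L Γ σ} → Form L (σ ∷ Γ) → Tm Γ σ → Form L Γ
φ [ t ] = subF (sub0 t) φ

subSucc : ∀ {Γ} → Sub (ι ∷ Γ) (ι ∷ Γ)
subSucc vz     = 𝕊 (var vz)
subSucc (vs v) = var (vs v)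

embed : ∀ {Γ} → Form base Γ → Form ext Γ
embed ⊥'       = ⊥'
embed (t ≡' u) = t ≡' u
embed (φ ∧' ψ) = embed φ ∧' embed ψ
embed (φ ∨' ψ) = embed φ ∨' embed ψ
embed (φ ⊃ ψ)  = embed φ ⊃ embed ψ
embed (∀' σ φ) = ∀' σ (embed φ)
embed (∃' σ φ) = ∃' σ (embed φ)

-- The interpretation φ ↦ φ^I, given formulas
--   E σ : Form base (σ ∷ [])        (free variable x = vz)
--   Q σ : Form base (σ ∷ σ ∷ [])    (free variables x = vz, y = vs vz)

EForms : Set
EForms = (σ : Ty) → Form base (σ ∷ [])

QForms : Set
QForms = (σ : Ty) → Form base (σ ∷ σ ∷ [])

sub1 : ∀ {Γ σ} → Tm Γ σ → Sub (σ ∷ []) Γ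
sub1 t vz = t

sub2 : ∀ {Γ σ} → Tm Γ σ → Tm Γ σ → Sub (σ ∷ σ ∷ []) Γ
sub2 s t vz      = s
sub2 s t (vs vz) = t

interp : ∀ {L Γ} → EForms → QForms → Form L Γ → Form base Γ
interp E Q ⊥'                  = ⊥'
interp E Q (t ≡' u)            = t ≡' u
interp E Q (Ext {σ = σ} t)     = subF (sub1 t) (E σ)
interp E Q (_=ₑ_ {σ = σ} s t)  = subF (sub2 s t) (Q σ)
interp E Q (φ ∧' ψ)            = interp E Q φ ∧' interp E Q ψ
interp E Q (φ ∨' ψ)            = interp E Q φ ∨' interp E Q ψ
interp E Q (φ ⊃ ψ)             = interp E Q φ ⊃ interp E Q ψ
interp E Q (∀' σ φ)            = ∀' σ (interp E Q φ)
interp E Q (∃' σ φ)            = ∃' σ (interp E Q φ)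

-- axioms of HA^ω (formulated in any language L; induction for all
-- formulas of L)
data AxBase {L : Lang} {Γ : Ctx} : Form L Γ → Set where
  ≡-refl  : ∀ {σ} (x : Tm Γ σ) → AxBase (x ≡' x)
  ≡-sym   : ∀ {σ} (x y : Tm Γ σ) → AxBase (x ≡' y ⊃ y ≡' x)
  ≡-trans : ∀ {σ} (x y z : Tm Γ σ) → AxBase (x ≡' y ⊃ y ≡' z ⊃ x ≡' z)
  ≡-app   : ∀ {σ τ} (x x' : Tm Γ (σ ⇒ τ)) (y y' : Tm Γ σ) →
            AxBase (x ≡' x' ⊃ y ≡' y' ⊃ (x · y) ≡' (x' · y'))
  ax-k    : ∀ {ρ σ} (x : Tm Γ ρ) (y : Tm Γ σ) → AxBase (𝕜 · x · y ≡' x)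
  ax-s    : ∀ {ρ σ τ} (x : Tm Γ (ρ ⇒ σ ⇒ τ)) (y : Tm Γ (ρ ⇒ σ)) (z : Tm Γ ρ) →
            AxBase (𝕤 · x · y · z ≡' x · z · (y · z))
  ax-fst  : ∀ {σ τ} (x : Tm Γ σ) (y : Tm Γ τ) → AxBase (fst · (pair · x · y) ≡' x)
  ax-snd  : ∀ {σ τ} (x : Tm Γ σ) (y : Tm Γ τ) → AxBase (snd · (pair · x · y) ≡' y)
  ax-R0   : ∀ {σ} (x : Tm Γ σ) (y : Tm Γ (ι ⇒ σ ⇒ σ)) → AxBase (ℝ · x · y · 𝟘 ≡' x)
  ax-RS   : ∀ {σ} (x : Tm Γ σ) (y : Tm Γ (ι ⇒ σ ⇒ σ)) (m : Tm Γ ι) →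
            AxBase (ℝ · x · y · 𝕊 m ≡' y · m · (ℝ · x · y · m))
  S-inj   : ∀ (x y : Tm Γ ι) → AxBase (𝕊 x ≡' 𝕊 y ⊃ x ≡' y)
  S≢0     : ∀ (x : Tm Γ ι) → AxBase (¬' (𝕊 x ≡' 𝟘))
  ind     : ∀ (φ : Form L (ι ∷ Γ)) →
            AxBase (φ [ 𝟘 ] ⊃ ∀' ι (φ ⊃ subF subSucc φ) ⊃ ∀' ι φ)

data AxH {Γ : Ctx} : Form ext Γ → Set where
  eq-0    : ∀ (x y : Tm Γ ι) → AxH (x =ₑ y ⇔' x ≡' y)
  ext-0   : ∀ (x : Tm Γ ι) → AxH (Ext x)
  eq-×    : ∀ {σ τ} (x y : Tm Γ (σ ⊗ τ)) →
            AxH (x =ₑ y ⇔' (fst · x =ₑ fst · y ∧' snd · x =ₑ snd · y))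
  ext-×   : ∀ {σ τ} (x : Tm Γ (σ ⊗ τ)) →
            AxH (Ext x ⇔' (Ext (fst · x) ∧' Ext (snd · x)))
  eq-→    : ∀ {σ τ} (f g : Tm Γ (σ ⇒ τ)) →
            AxH (f =ₑ g ⇔' ∀' σ (Ext (var vz) ⊃ wkT f · var vz =ₑ wkT g · var vz))
  ext-app : ∀ {σ τ} (f : Tm Γ (σ ⇒ τ)) (x : Tm Γ σ) →
            AxH (Ext f ⊃ Ext x ⊃ Ext (f · x))
  ext-≡   : ∀ {σ} (x y : Tm Γ σ) → AxH (x ≡' y ⊃ Ext x ⊃ Ext y)
  ext-con : ∀ {σ} (c : Const σ) → AxH (Ext (con c))

data AxE {Γ : Ctx} : Form ext Γ → Set where
  extensionality : ∀ {σ τ} (f : Tm Γ (σ ⇒ τ)) (x y : Tm Γ σ) →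
    AxE (Ext f ⊃ Ext x ⊃ Ext y ⊃ x =ₑ y ⊃ f · x =ₑ f · y)

Axioms : Lang → Set₁
Axioms L = ∀ {Γ} → Form L Γ → Set

HA-Ax : Axioms base
HA-Ax φ = AxBase φ

H-Ax : Axioms ext
H-Ax φ = AxBase φ ⊎ AxH φ

HE-Ax : Axioms ext
HE-Ax φ = AxBase φ ⊎ AxH φ ⊎ AxE φ

-- Intuitionistic many-sorted natural deduction.
-- Der A Γ Δ φ : φ is derivable from axioms A and hypotheses Δ,
-- all with free variables in Γ.

data Der {L : Lang} (A : Axioms L) : (Γ : Ctx) → List (Form L Γ) → Form L Γ → Set where
  ax   : ∀ {Γ Δ φ} → A φ → Der A Γ Δ φ
  hyp  : ∀ {Γ Δ φ} → φ ∈ Δ → Der A Γ Δ φ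
  ⊥E   : ∀ {Γ Δ φ} → Der A Γ Δ ⊥' → Der A Γ Δ φ
  ∧I   : ∀ {Γ Δ φ ψ} → Der A Γ Δ φ → Der A Γ Δ ψ → Der A Γ Δ (φ ∧' ψ)
  ∧E₁  : ∀ {Γ Δ φ ψ} → Der A Γ Δ (φ ∧' ψ) → Der A Γ Δ φ
  ∧E₂  : ∀ {Γ Δ φ ψ} → Der A Γ Δ (φ ∧' ψ) → Der A Γ Δ ψ
  ∨I₁  : ∀ {Γ Δ φ ψ} → Der A Γ Δ φ → Der A Γ Δ (φ ∨' ψ)
  ∨I₂  : ∀ {Γ Δ φ ψ} → Der A Γ Δ ψ → Der A Γ Δ (φ ∨' ψ)
  ∨E   : ∀ {Γ Δ φ ψ χ} → Der A Γ Δ (φ ∨' ψ) →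
         Der A Γ (φ ∷ Δ) χ → Der A Γ (ψ ∷ Δ) χ → Der A Γ Δ χ
  ⊃I   : ∀ {Γ Δ φ ψ} → Der A Γ (φ ∷ Δ) ψ → Der A Γ Δ (φ ⊃ ψ)
  ⊃E   : ∀ {Γ Δ φ ψ} → Der A Γ Δ (φ ⊃ ψ) → Der A Γ Δ φ → Der A Γ Δ ψ
  ∀I   : ∀ {Γ Δ σ φ} → Der A (σ ∷ Γ) (map wkF Δ) φ → Der A Γ Δ (∀' σ φ)
  ∀E   : ∀ {Γ Δ σ φ} → Der A Γ Δ (∀' σ φ) → (t : Tm Γ σ) → Der A Γ Δ (φ [ t ])
  ∃I   : ∀ {Γ Δ σ φ} (t : Tm Γ σ) → Der A Γ Δ (φ [ t ]) → Der A Γ Δ (∃' σ φ)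
  ∃E   : ∀ {Γ Δ σ φ ψ} → Der A Γ Δ (∃' σ φ) →
         Der A (σ ∷ Γ) (φ ∷ map wkF Δ) (wkF ψ) → Der A Γ Δ ψ

-- provability (without hypotheses); formulas may contain free variables
_⊢HA_ : ∀ Γ → Form base Γ → Set
Γ ⊢HA φ = Der HA-Ax Γ [] φ

_⊢HE_ : ∀ Γ → Form ext Γ → Set
Γ ⊢HE φ = Der HE-Ax Γ [] φ

{-# OPTIONS --safe #-}
module Submission where

-- Interpret Ext_σ as hereditary extensionality and =_σ as hereditary
-- extensional equality, both by recursion on σ: at type 0 every object is
-- extensional and = is ≡; at σ × τ both are taken componentwise; f : σ → τ is
-- extensional if it sends extensional arguments to extensional values and
-- equal extensional arguments to equal values, and f = g means f x = g x for
-- every extensional x.  Then the extensionality axiom holds by definition,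
-- the axioms for Ext and = are unfoldings of the definition, and HA^ω proves
-- every constant extensional, the recursor by induction on its numeral
-- argument.  As the translation commutes with substitution, it maps
-- derivations to derivations, and it fixes every HA^ω-formula.

open import Defs
open import Data.Product using (Σ; _×_; _,_)
open import Data.Sum using (inj₁; inj₂)
open import Data.List using (List; []; _∷_; map; length; lookup)
open import Data.Nat using (ℕ; _<?_)
open import Data.Fin using (fromℕ<)
open import Relation.Nullary.Decidable using (True; toWitness)
open import Data.List.Membership.Propositional.Properties using (∈-map⁺; ∈-lookup)
open import Relation.Binary.PropositionalEquality using (_≡_; refl; sym; trans; cong; cong₂; subst)

v₀ : ∀ {Γ σ} → Tm (σ ∷ Γ) σ
v₀ = var vz

v₁ : ∀ {Γ σ τ} → Tm (τ ∷ σ ∷ Γ) σ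
v₁ = var (vs vz)

subT-vs : ∀ {Γ σ τ} (t : Tm Γ σ) → subT (λ v → var (vs {τ = τ} v)) t ≡ wkT t
subT-vs (var v) = refl
subT-vs (con c) = refl
subT-vs (t · u) = cong₂ _·_ (subT-vs t) (subT-vs u)

subT-liftS-wkT : ∀ {Γ Δ σ τ} (s : Sub Γ Δ) (t : Tm Γ σ) →
  subT (liftS {τ = τ} s) (wkT t) ≡ wkT (subT s t)
subT-liftS-wkT s (var v) = refl
subT-liftS-wkT s (con c) = refl
subT-liftS-wkT s (t · u) = cong₂ _·_ (subT-liftS-wkT s t) (subT-liftS-wkT s u)

subT-sub0-wkT : ∀ {Γ σ τ} (u : Tm Γ τ) (t : Tm Γ σ) → subT (sub0 u) (wkT t) ≡ t
subT-sub0-wkT u (var v) = refl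
subT-sub0-wkT u (con c) = refl
subT-sub0-wkT u (t · t') = cong₂ _·_ (subT-sub0-wkT u t) (subT-sub0-wkT u t')

subT-subSucc-wkT : ∀ {Γ σ} (t : Tm Γ σ) → subT subSucc (wkT t) ≡ wkT t
subT-subSucc-wkT (var v) = refl
subT-subSucc-wkT (con c) = refl
subT-subSucc-wkT (t · u) = cong₂ _·_ (subT-subSucc-wkT t) (subT-subSucc-wkT u)

mutual
  HExt : ∀ {Γ} σ → Tm Γ σ → Form base Γ
  HExt ι       x = 𝟘 ≡' 𝟘
  HExt (σ ⊗ τ) x = HExt σ (fst · x) ∧' HExt τ (snd · x)
  HExt (σ ⇒ τ) f = ∀' σ (∀' σ (HExt σ v₁ ⊃ HExt σ v₀ ⊃ HEq σ v₁ v₀ ⊃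
    HExt τ (wkT (wkT f) · v₁) ∧' HEq τ (wkT (wkT f) · v₁) (wkT (wkT f) · v₀)))

  HEq : ∀ {Γ} σ → Tm Γ σ → Tm Γ σ → Form base Γ
  HEq ι       x y = x ≡' y
  HEq (σ ⊗ τ) x y = HEq σ (fst · x) (fst · y) ∧' HEq τ (snd · x) (snd · y)
  HEq (σ ⇒ τ) f g = ∀' σ (HExt σ v₀ ⊃ HEq τ (wkT f · v₀) (wkT g · v₀))

mutual
  subF-HExt : ∀ {Γ Δ} (s : Sub Γ Δ) σ (t : Tm Γ σ) → subF s (HExt σ t) ≡ HExt σ (subT s t)
  subF-HExt s ι       t = refl
  subF-HExt s (σ ⊗ τ) t = cong₂ _∧'_ (subF-HExt s σ (fst · t)) (subF-HExt s τ (snd · t))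
  subF-HExt s (σ ⇒ τ) f =
    cong (∀' σ) (cong (∀' σ) (cong₂ _⊃_ (subF-HExt s₂ σ v₁) (cong₂ _⊃_ (subF-HExt s₂ σ v₀)
      (cong₂ _⊃_ (subF-HEq s₂ σ v₁ v₀) (cong₂ _∧'_
        (trans (subF-HExt s₂ τ (F · v₁)) (cong (λ G → HExt τ (G · v₁)) F≡))
        (trans (subF-HEq s₂ τ (F · v₁) (F · v₀)) (cong (λ G → HEq τ (G · v₁) (G · v₀)) F≡)))))))
    where
    s₂ = liftS (liftS s)
    F = wkT (wkT f)
    F≡ : subT s₂ F ≡ wkT (wkT (subT s f))
    F≡ = trans (subT-liftS-wkT (liftS s) (wkT f)) (cong wkT (subT-liftS-wkT s f))

  subF-HEq : ∀ {Γ Δ} (s : Sub Γ Δ) σ (x y : Tm Γ σ) →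
    subF s (HEq σ x y) ≡ HEq σ (subT s x) (subT s y)
  subF-HEq s ι       x y = refl
  subF-HEq s (σ ⊗ τ) x y =
    cong₂ _∧'_ (subF-HEq s σ (fst · x) (fst · y)) (subF-HEq s τ (snd · x) (snd · y))
  subF-HEq s (σ ⇒ τ) f g = cong (∀' σ) (cong₂ _⊃_ (subF-HExt (liftS s) σ v₀)
    (trans (subF-HEq (liftS s) τ (wkT f · v₀) (wkT g · v₀))
           (cong₂ (λ u v → HEq τ (u · v₀) (v · v₀)) (subT-liftS-wkT s f) (subT-liftS-wkT s g))))

infix 2 _∣_⊢_
_∣_⊢_ : (Γ : Ctx) → List (Form base Γ) → Form base Γ → Set
Γ ∣ Δ ⊢ φ = Der HA-Ax Γ Δ φ

cast : ∀ {Γ Δ φ ψ} → φ ≡ ψ → Γ ∣ Δ ⊢ φ → Γ ∣ Δ ⊢ ψ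
cast refl d = d

infixl 5 _!_
_!_ : ∀ {Γ Δ φ ψ} → Γ ∣ Δ ⊢ φ ⊃ ψ → Γ ∣ Δ ⊢ φ → Γ ∣ Δ ⊢ ψ
_!_ = ⊃E

h : ∀ {Γ Δ} (i : ℕ) {i<∣Δ∣ : True (i <? length Δ)} → Γ ∣ Δ ⊢ lookup Δ (fromℕ< (toWitness i<∣Δ∣))
h i {i<∣Δ∣} = hyp (∈-lookup (fromℕ< (toWitness i<∣Δ∣)))

⊢refl : ∀ {Γ Δ σ} (x : Tm Γ σ) → Γ ∣ Δ ⊢ x ≡' x
⊢refl x = ax (≡-refl x)

⊢sym : ∀ {Γ Δ σ} {x y : Tm Γ σ} → Γ ∣ Δ ⊢ x ≡' y → Γ ∣ Δ ⊢ y ≡' x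
⊢sym {x = x} {y} d = ax (≡-sym x y) ! d

⊢trans : ∀ {Γ Δ σ} {x y z : Tm Γ σ} → Γ ∣ Δ ⊢ x ≡' y → Γ ∣ Δ ⊢ y ≡' z → Γ ∣ Δ ⊢ x ≡' z
⊢trans {x = x} {y} {z} d e = ax (≡-trans x y z) ! d ! e

⊢app : ∀ {Γ Δ σ τ} {f f' : Tm Γ (σ ⇒ τ)} {x x' : Tm Γ σ} →
  Γ ∣ Δ ⊢ f ≡' f' → Γ ∣ Δ ⊢ x ≡' x' → Γ ∣ Δ ⊢ f · x ≡' f' · x'
⊢app {f = f} {f'} {x} {x'} d e = ax (≡-app f f' x x') ! d ! e

⊢appʳ : ∀ {Γ Δ σ τ} (f : Tm Γ (σ ⇒ τ)) {x x' : Tm Γ σ} →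
  Γ ∣ Δ ⊢ x ≡' x' → Γ ∣ Δ ⊢ f · x ≡' f · x'
⊢appʳ f = ⊢app (⊢refl f)

⊢ind : ∀ {Γ Δ} (φ : Form base (ι ∷ Γ)) →
  Γ ∣ Δ ⊢ φ [ 𝟘 ] → ι ∷ Γ ∣ φ ∷ map wkF Δ ⊢ subF subSucc φ → Γ ∣ Δ ⊢ ∀' ι φ
⊢ind φ d₀ dₛ = ax (ind φ) ! d₀ ! ∀I (⊃I dₛ)

wkF-HExt : ∀ {Γ τ} σ (t : Tm Γ σ) → wkF {τ = τ} (HExt σ t) ≡ HExt σ (wkT t)
wkF-HExt σ t = trans (subF-HExt (λ v → var (vs v)) σ t) (cong (HExt σ) (subT-vs t))

wkF-HEq : ∀ {Γ τ} σ (x y : Tm Γ σ) → wkF {τ = τ} (HEq σ x y) ≡ HEq σ (wkT x) (wkT y)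
wkF-HEq σ x y = trans (subF-HEq (λ v → var (vs v)) σ x y) (cong₂ (HEq σ) (subT-vs x) (subT-vs y))

wkF-≡' : ∀ {Γ τ σ} (x y : Tm Γ σ) → wkF {base} {τ = τ} (x ≡' y) ≡ (wkT x ≡' wkT y)
wkF-≡' x y = cong₂ _≡'_ (subT-vs x) (subT-vs y)

wk-HExt : ∀ {Γ τ Δ} σ (t : Tm Γ σ) → τ ∷ Γ ∣ Δ ⊢ wkF (HExt σ t) → τ ∷ Γ ∣ Δ ⊢ HExt σ (wkT t)
wk-HExt σ t = cast (wkF-HExt σ t)

wk²-HExt : ∀ {Γ τ ρ Δ} σ (t : Tm Γ σ) →
  ρ ∷ τ ∷ Γ ∣ Δ ⊢ wkF (wkF (HExt σ t)) → ρ ∷ τ ∷ Γ ∣ Δ ⊢ HExt σ (wkT (wkT t))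
wk²-HExt σ t d = wk-HExt σ (wkT t) (cast (cong wkF (wkF-HExt σ t)) d)

wk-HEq : ∀ {Γ τ Δ} σ (x y : Tm Γ σ) →
  τ ∷ Γ ∣ Δ ⊢ wkF (HEq σ x y) → τ ∷ Γ ∣ Δ ⊢ HEq σ (wkT x) (wkT y)
wk-HEq σ x y = cast (wkF-HEq σ x y)

wk-≡' : ∀ {Γ τ σ Δ} (x y : Tm Γ σ) → τ ∷ Γ ∣ Δ ⊢ wkF (x ≡' y) → τ ∷ Γ ∣ Δ ⊢ wkT x ≡' wkT y
wk-≡' x y = cast (wkF-≡' x y)

wk²-≡' : ∀ {Γ τ ρ σ Δ} (x y : Tm Γ σ) →
  ρ ∷ τ ∷ Γ ∣ Δ ⊢ wkF (wkF (x ≡' y)) → ρ ∷ τ ∷ Γ ∣ Δ ⊢ wkT (wkT x) ≡' wkT (wkT y)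
wk²-≡' x y d = wk-≡' (wkT x) (wkT y) (cast (cong wkF (wkF-≡' x y)) d)

HExt-⇒-intro : ∀ {Γ Δ σ τ} (f : Tm Γ (σ ⇒ τ)) →
  let F = wkT (wkT f)
      Θ = HEq σ v₁ v₀ ∷ HExt σ v₀ ∷ HExt σ v₁ ∷ map wkF (map wkF Δ) in
  σ ∷ σ ∷ Γ ∣ Θ ⊢ HExt τ (F · v₁) → σ ∷ σ ∷ Γ ∣ Θ ⊢ HEq τ (F · v₁) (F · v₀) →
  Γ ∣ Δ ⊢ HExt (σ ⇒ τ) f
HExt-⇒-intro f d e = ∀I (∀I (⊃I (⊃I (⊃I (∧I d e)))))

HEq-⇒-intro : ∀ {Γ Δ σ τ} (f g : Tm Γ (σ ⇒ τ)) →
  σ ∷ Γ ∣ HExt σ v₀ ∷ map wkF Δ ⊢ HEq τ (wkT f · v₀) (wkT g · v₀) →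
  Γ ∣ Δ ⊢ HEq (σ ⇒ τ) f g
HEq-⇒-intro f g d = ∀I (⊃I d)

HExt-⇒-elim : ∀ {Γ Δ σ τ} {f : Tm Γ (σ ⇒ τ)} → Γ ∣ Δ ⊢ HExt (σ ⇒ τ) f → (a b : Tm Γ σ) →
  Γ ∣ Δ ⊢ HExt σ a ⊃ HExt σ b ⊃ HEq σ a b ⊃ HExt τ (f · a) ∧' HEq τ (f · a) (f · b)
HExt-⇒-elim {σ = σ} {τ} {f} d a b = cast instantiate (∀E (∀E d a) b)
  where
  s₀ = sub0 b
  s₁ = liftS (sub0 a)
  a≡ : subT s₀ (subT s₁ v₁) ≡ a
  a≡ = subT-sub0-wkT b a
  f≡ : subT s₀ (subT s₁ (wkT (wkT f))) ≡ f
  f≡ = trans (cong (subT s₀) (trans (subT-liftS-wkT (sub0 a) (wkT f))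
                                    (cong wkT (subT-sub0-wkT a f))))
             (subT-sub0-wkT b f)
  subF²-HExt : ∀ ρ (t : Tm (σ ∷ σ ∷ _) ρ) →
    subF s₀ (subF s₁ (HExt ρ t)) ≡ HExt ρ (subT s₀ (subT s₁ t))
  subF²-HExt ρ t = trans (cong (subF s₀) (subF-HExt s₁ ρ t)) (subF-HExt s₀ ρ (subT s₁ t))
  subF²-HEq : ∀ ρ (t u : Tm (σ ∷ σ ∷ _) ρ) →
    subF s₀ (subF s₁ (HEq ρ t u)) ≡ HEq ρ (subT s₀ (subT s₁ t)) (subT s₀ (subT s₁ u))
  subF²-HEq ρ t u =
    trans (cong (subF s₀) (subF-HEq s₁ ρ t u)) (subF-HEq s₀ ρ (subT s₁ t) (subT s₁ u))
  F = wkT (wkT f)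
  instantiate = cong₂ _⊃_ (trans (subF²-HExt σ v₁) (cong (HExt σ) a≡))
    (cong₂ _⊃_ (subF²-HExt σ v₀)
    (cong₂ _⊃_ (trans (subF²-HEq σ v₁ v₀) (cong (λ u → HEq σ u b) a≡))
    (cong₂ _∧'_ (trans (subF²-HExt τ (F · v₁)) (cong (HExt τ) (cong₂ _·_ f≡ a≡)))
                (trans (subF²-HEq τ (F · v₁) (F · v₀))
                       (cong₂ (λ u v → HEq τ (u · v) (u · b)) f≡ a≡)))))

HEq-⇒-elim : ∀ {Γ Δ σ τ} {f g : Tm Γ (σ ⇒ τ)} → Γ ∣ Δ ⊢ HEq (σ ⇒ τ) f g → (a : Tm Γ σ) →
  Γ ∣ Δ ⊢ HExt σ a ⊃ HEq τ (f · a) (g · a)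
HEq-⇒-elim {σ = σ} {τ} {f} {g} d a = cast instantiate (∀E d a)
  where
  instantiate = cong₂ _⊃_ (subF-HExt (sub0 a) σ v₀)
    (trans (subF-HEq (sub0 a) τ (wkT f · v₀) (wkT g · v₀))
           (cong₂ (λ u v → HEq τ (u · a) (v · a)) (subT-sub0-wkT a f) (subT-sub0-wkT a g)))

HEq-refl : ∀ {Γ Δ} σ (t : Tm Γ σ) → Γ ∣ Δ ⊢ HExt σ t ⊃ HEq σ t t
HEq-refl ι       t = ⊃I (⊢refl t)
HEq-refl (σ ⊗ τ) t = ⊃I (∧I (HEq-refl σ (fst · t) ! ∧E₁ (h 0)) (HEq-refl τ (snd · t) ! ∧E₂ (h 0)))
HEq-refl (σ ⇒ τ) f = ⊃I (HEq-⇒-intro f f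
  (∧E₂ (HExt-⇒-elim (wk-HExt (σ ⇒ τ) f (h 1)) v₀ v₀ ! (h 0) ! (h 0) ! (HEq-refl σ v₀ ! (h 0)))))

HEq-trans : ∀ {Γ Δ} σ (a b c : Tm Γ σ) → Γ ∣ Δ ⊢ HEq σ a b ⊃ HEq σ b c ⊃ HEq σ a c
HEq-trans ι       a b c = ⊃I (⊃I (⊢trans (h 1) (h 0)))
HEq-trans (σ ⊗ τ) a b c = ⊃I (⊃I (∧I
  (HEq-trans σ (fst · a) (fst · b) (fst · c) ! ∧E₁ (h 1) ! ∧E₁ (h 0))
  (HEq-trans τ (snd · a) (snd · b) (snd · c) ! ∧E₂ (h 1) ! ∧E₂ (h 0))))
HEq-trans (σ ⇒ τ) a b c = ⊃I (⊃I (HEq-⇒-intro a c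
  (HEq-trans τ (wkT a · v₀) (wkT b · v₀) (wkT c · v₀)
    ! (HEq-⇒-elim (wk-HEq (σ ⇒ τ) a b (h 2)) v₀ ! (h 0))
    ! (HEq-⇒-elim (wk-HEq (σ ⇒ τ) b c (h 1)) v₀ ! (h 0)))))

HEq-resp-≡ : ∀ {Γ Δ} σ (x x' y y' : Tm Γ σ) →
  Γ ∣ Δ ⊢ x ≡' x' ⊃ y ≡' y' ⊃ HEq σ x y ⊃ HEq σ x' y'
HEq-resp-≡ ι       x x' y y' = ⊃I (⊃I (⊃I (⊢trans (⊢sym (h 2)) (⊢trans (h 0) (h 1)))))
HEq-resp-≡ (σ ⊗ τ) x x' y y' = ⊃I (⊃I (⊃I (∧I
  (HEq-resp-≡ σ (fst · x) (fst · x') (fst · y) (fst · y')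
    ! ⊢appʳ fst (h 2) ! ⊢appʳ fst (h 1) ! ∧E₁ (h 0))
  (HEq-resp-≡ τ (snd · x) (snd · x') (snd · y) (snd · y')
    ! ⊢appʳ snd (h 2) ! ⊢appʳ snd (h 1) ! ∧E₂ (h 0)))))
HEq-resp-≡ (σ ⇒ τ) f f' g g' = ⊃I (⊃I (⊃I (HEq-⇒-intro f' g'
  (HEq-resp-≡ τ (wkT f · v₀) (wkT f' · v₀) (wkT g · v₀) (wkT g' · v₀)
    ! ⊢app (wk-≡' f f' (h 3)) (⊢refl v₀) ! ⊢app (wk-≡' g g' (h 2)) (⊢refl v₀)
    ! (HEq-⇒-elim (wk-HEq (σ ⇒ τ) f g (h 1)) v₀ ! (h 0))))))

HExt-resp-≡ : ∀ {Γ Δ} σ (x y : Tm Γ σ) → Γ ∣ Δ ⊢ x ≡' y ⊃ HExt σ x ⊃ HExt σ y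
HExt-resp-≡ ι       x y = ⊃I (⊃I (h 0))
HExt-resp-≡ (σ ⊗ τ) x y = ⊃I (⊃I (∧I
  (HExt-resp-≡ σ (fst · x) (fst · y) ! ⊢appʳ fst (h 1) ! ∧E₁ (h 0))
  (HExt-resp-≡ τ (snd · x) (snd · y) ! ⊢appʳ snd (h 1) ! ∧E₂ (h 0))))
HExt-resp-≡ (σ ⇒ τ) f g = ⊃I (⊃I (HExt-⇒-intro g
  (HExt-resp-≡ τ (F · v₁) (G · v₁) ! ⊢app F≡G (⊢refl v₁) ! ∧E₁ Ff)
  (HEq-resp-≡ τ (F · v₁) (G · v₁) (F · v₀) (G · v₀)
    ! ⊢app F≡G (⊢refl v₁) ! ⊢app F≡G (⊢refl v₀) ! ∧E₂ Ff)))
  where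
  F = wkT (wkT f)
  G = wkT (wkT g)
  F≡G = wk²-≡' f g (h 4)
  Ff = HExt-⇒-elim (wk²-HExt (σ ⇒ τ) f (h 3)) v₁ v₀ ! (h 2) ! (h 1) ! (h 0)

HExt-expand : ∀ {Γ Δ σ} {x x' : Tm Γ σ} →
  Γ ∣ Δ ⊢ x' ≡' x → Γ ∣ Δ ⊢ HExt σ x → Γ ∣ Δ ⊢ HExt σ x'
HExt-expand {σ = σ} {x} {x'} d e = HExt-resp-≡ σ x x' ! ⊢sym d ! e

HEq-expand : ∀ {Γ Δ σ} {x x' y y' : Tm Γ σ} →
  Γ ∣ Δ ⊢ x' ≡' x → Γ ∣ Δ ⊢ y' ≡' y → Γ ∣ Δ ⊢ HEq σ x y → Γ ∣ Δ ⊢ HEq σ x' y'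
HEq-expand {σ = σ} {x} {x'} {y} {y'} d e q = HEq-resp-≡ σ x x' y y' ! ⊢sym d ! ⊢sym e ! q

HExt-app : ∀ {Γ Δ} σ τ (f : Tm Γ (σ ⇒ τ)) (x : Tm Γ σ) →
  Γ ∣ Δ ⊢ HExt (σ ⇒ τ) f ⊃ HExt σ x ⊃ HExt τ (f · x)
HExt-app σ τ f x = ⊃I (⊃I (∧E₁ (HExt-⇒-elim (h 1) x x ! (h 0) ! (h 0) ! (HEq-refl σ x ! (h 0)))))

HExt-extensional : ∀ {Γ Δ} σ τ (f : Tm Γ (σ ⇒ τ)) (x y : Tm Γ σ) →
  Γ ∣ Δ ⊢ HExt (σ ⇒ τ) f ⊃ HExt σ x ⊃ HExt σ y ⊃ HEq σ x y ⊃ HEq τ (f · x) (f · y)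
HExt-extensional σ τ f x y = ⊃I (⊃I (⊃I (⊃I (∧E₂ (HExt-⇒-elim (h 3) x y ! (h 2) ! (h 1) ! (h 0))))))

HExt-k₁ : ∀ {Γ Δ} ρ σ (x : Tm Γ ρ) → Γ ∣ Δ ⊢ HExt ρ x ⊃ HExt (σ ⇒ ρ) (𝕜 · x)
HExt-k₁ ρ σ x = ⊃I (HExt-⇒-intro (𝕜 · x)
  (HExt-expand (ax (ax-k X v₁)) Ex)
  (HEq-expand (ax (ax-k X v₁)) (ax (ax-k X v₀)) (HEq-refl ρ X ! Ex)))
  where
  X = wkT (wkT x)
  Ex = wk²-HExt ρ x (h 3)

HEq-k₁ : ∀ {Γ Δ} ρ σ (x y : Tm Γ ρ) → Γ ∣ Δ ⊢ HEq ρ x y ⊃ HEq (σ ⇒ ρ) (𝕜 · x) (𝕜 · y)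
HEq-k₁ ρ σ x y = ⊃I (HEq-⇒-intro (𝕜 · x) (𝕜 · y)
  (HEq-expand (ax (ax-k (wkT x) v₀)) (ax (ax-k (wkT y) v₀)) (wk-HEq ρ x y (h 1))))

HExt-k : ∀ {Γ Δ} ρ σ → Γ ∣ Δ ⊢ HExt (ρ ⇒ σ ⇒ ρ) (con (kc ρ σ))
HExt-k ρ σ = HExt-⇒-intro 𝕜 (HExt-k₁ ρ σ v₁ ! (h 2)) (HEq-k₁ ρ σ v₁ v₀ ! (h 0))

module _ {ρ σ τ : Ty} where

  HExt-s₂ : ∀ {Γ Δ} (x : Tm Γ (ρ ⇒ σ ⇒ τ)) (y : Tm Γ (ρ ⇒ σ)) →
    Γ ∣ Δ ⊢ HExt (ρ ⇒ σ ⇒ τ) x ⊃ HExt (ρ ⇒ σ) y ⊃ HExt (ρ ⇒ τ) (𝕤 · x · y)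
  HExt-s₂ x y = ⊃I (⊃I (HExt-⇒-intro (𝕤 · x · y)
    (HExt-expand (ax (ax-s X Y v₁)) (HExt-app σ τ (X · v₁) (Y · v₁) ! ∧E₁ Xa ! ∧E₁ Ya))
    (HEq-expand (ax (ax-s X Y v₁)) (ax (ax-s X Y v₀))
      (HEq-trans τ (X · v₁ · (Y · v₁)) (X · v₁ · (Y · v₀)) (X · v₀ · (Y · v₀))
        ! ∧E₂ (HExt-⇒-elim (∧E₁ Xa) (Y · v₁) (Y · v₀) ! ∧E₁ Ya ! Yb ! ∧E₂ Ya)
        ! (HEq-⇒-elim (∧E₂ Xa) (Y · v₀) ! Yb)))))
    where
    X = wkT (wkT x)
    Y = wkT (wkT y)
    Ex = wk²-HExt (ρ ⇒ σ ⇒ τ) x (h 4)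
    Ey = wk²-HExt (ρ ⇒ σ) y (h 3)
    Xa = HExt-⇒-elim Ex v₁ v₀ ! (h 2) ! (h 1) ! (h 0)
    Ya = HExt-⇒-elim Ey v₁ v₀ ! (h 2) ! (h 1) ! (h 0)
    Yb = HExt-app ρ σ Y v₀ ! Ey ! (h 1)

  HEq-s₂ : ∀ {Γ Δ} (x x' : Tm Γ (ρ ⇒ σ ⇒ τ)) (y y' : Tm Γ (ρ ⇒ σ)) →
    Γ ∣ Δ ⊢ HExt (ρ ⇒ σ ⇒ τ) x ⊃ HEq (ρ ⇒ σ ⇒ τ) x x' ⊃
            HExt (ρ ⇒ σ) y ⊃ HExt (ρ ⇒ σ) y' ⊃ HEq (ρ ⇒ σ) y y' ⊃
            HEq (ρ ⇒ τ) (𝕤 · x · y) (𝕤 · x' · y')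
  HEq-s₂ x x' y y' = ⊃I (⊃I (⊃I (⊃I (⊃I (HEq-⇒-intro (𝕤 · x · y) (𝕤 · x' · y')
    (HEq-expand (ax (ax-s X Y v₀)) (ax (ax-s X' Y' v₀))
      (HEq-trans τ (X · v₀ · (Y · v₀)) (X · v₀ · (Y' · v₀)) (X' · v₀ · (Y' · v₀))
        ! vary-argument ! vary-function)))))))
    where
    X = wkT x
    X' = wkT x'
    Y = wkT y
    Y' = wkT y'
    Xz = HExt-app ρ (σ ⇒ τ) X v₀ ! wk-HExt (ρ ⇒ σ ⇒ τ) x (h 5) ! (h 0)
    Yz = HExt-app ρ σ Y v₀ ! wk-HExt (ρ ⇒ σ) y (h 3) ! (h 0)
    Y'z = HExt-app ρ σ Y' v₀ ! wk-HExt (ρ ⇒ σ) y' (h 2) ! (h 0)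
    vary-argument = ∧E₂ (HExt-⇒-elim Xz (Y · v₀) (Y' · v₀) ! Yz ! Y'z
                          ! (HEq-⇒-elim (wk-HEq (ρ ⇒ σ) y y' (h 1)) v₀ ! (h 0)))
    vary-function = HEq-⇒-elim (HEq-⇒-elim (wk-HEq (ρ ⇒ σ ⇒ τ) x x' (h 4)) v₀ ! (h 0)) (Y' · v₀) ! Y'z

  HExt-s₁ : ∀ {Γ Δ} (x : Tm Γ (ρ ⇒ σ ⇒ τ)) →
    Γ ∣ Δ ⊢ HExt (ρ ⇒ σ ⇒ τ) x ⊃ HExt ((ρ ⇒ σ) ⇒ ρ ⇒ τ) (𝕤 · x)
  HExt-s₁ x = ⊃I (HExt-⇒-intro (𝕤 · x)
    (HExt-s₂ X v₁ ! Ex ! (h 2))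
    (HEq-s₂ X X v₁ v₀ ! Ex ! (HEq-refl _ X ! Ex) ! (h 2) ! (h 1) ! (h 0)))
    where
    X = wkT (wkT x)
    Ex = wk²-HExt (ρ ⇒ σ ⇒ τ) x (h 3)

  HExt-s : ∀ {Γ Δ} → Γ ∣ Δ ⊢ HExt ((ρ ⇒ σ ⇒ τ) ⇒ (ρ ⇒ σ) ⇒ ρ ⇒ τ) (con (sc ρ σ τ))
  HExt-s = HExt-⇒-intro 𝕤 (HExt-s₁ v₁ ! (h 2)) (HEq-⇒-intro (𝕤 · v₁) (𝕤 · v₀)
    (HEq-s₂ (wkT v₁) (wkT v₀) v₀ v₀
      ! wk-HExt _ v₁ (h 3) ! wk-HEq _ v₁ v₀ (h 1) ! (h 0) ! (h 0) ! (HEq-refl _ v₀ ! (h 0))))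

HExt-pair₁ : ∀ {Γ Δ} σ τ (x : Tm Γ σ) → Γ ∣ Δ ⊢ HExt σ x ⊃ HExt (τ ⇒ σ ⊗ τ) (pair · x)
HExt-pair₁ σ τ x = ⊃I (HExt-⇒-intro (pair · x)
  (∧I (HExt-expand (ax (ax-fst X v₁)) Ex) (HExt-expand (ax (ax-snd X v₁)) (h 2)))
  (∧I (HEq-expand (ax (ax-fst X v₁)) (ax (ax-fst X v₀)) (HEq-refl σ X ! Ex))
      (HEq-expand (ax (ax-snd X v₁)) (ax (ax-snd X v₀)) (h 0))))
  where
  X = wkT (wkT x)
  Ex = wk²-HExt σ x (h 3)

HEq-pair₁ : ∀ {Γ Δ} σ τ (x y : Tm Γ σ) → Γ ∣ Δ ⊢ HEq σ x y ⊃ HEq (τ ⇒ σ ⊗ τ) (pair · x) (pair · y)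
HEq-pair₁ σ τ x y = ⊃I (HEq-⇒-intro (pair · x) (pair · y) (∧I
  (HEq-expand (ax (ax-fst (wkT x) v₀)) (ax (ax-fst (wkT y) v₀)) (wk-HEq σ x y (h 1)))
  (HEq-expand (ax (ax-snd (wkT x) v₀)) (ax (ax-snd (wkT y) v₀)) (HEq-refl τ v₀ ! (h 0)))))

HExt-pair : ∀ {Γ Δ} σ τ → Γ ∣ Δ ⊢ HExt (σ ⇒ τ ⇒ σ ⊗ τ) (con (pairc σ τ))
HExt-pair σ τ = HExt-⇒-intro pair (HExt-pair₁ σ τ v₁ ! (h 2)) (HEq-pair₁ σ τ v₁ v₀ ! (h 0))

HExt-fst : ∀ {Γ Δ} σ τ → Γ ∣ Δ ⊢ HExt (σ ⊗ τ ⇒ σ) (con (fstc σ τ))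
HExt-fst σ τ = HExt-⇒-intro fst (∧E₁ (h 2)) (∧E₁ (h 0))

HExt-snd : ∀ {Γ Δ} σ τ → Γ ∣ Δ ⊢ HExt (σ ⊗ τ ⇒ τ) (con (sndc σ τ))
HExt-snd σ τ = HExt-⇒-intro snd (∧E₂ (h 2)) (∧E₂ (h 0))

HExt-succ : ∀ {Γ Δ} → Γ ∣ Δ ⊢ HExt (ι ⇒ ι) (con succc)
HExt-succ = HExt-⇒-intro (con succc) (⊢refl 𝟘) (⊢appʳ (con succc) (h 0))

module _ {σ : Ty} where

  subT-sub0-R : ∀ {Γ} (x : Tm Γ σ) (y : Tm Γ (ι ⇒ σ ⇒ σ)) (n : Tm Γ ι) →
    subT (sub0 n) (ℝ · wkT x · wkT y · v₀) ≡ ℝ · x · y · n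
  subT-sub0-R x y n = cong₂ (λ u v → ℝ · u · v · n) (subT-sub0-wkT n x) (subT-sub0-wkT n y)

  subT-subSucc-R : ∀ {Γ} (x : Tm Γ σ) (y : Tm Γ (ι ⇒ σ ⇒ σ)) →
    subT subSucc (ℝ · wkT x · wkT y · v₀) ≡ ℝ · wkT x · wkT y · 𝕊 v₀
  subT-subSucc-R x y =
    cong₂ (λ u v → ℝ · u · v · 𝕊 v₀) (subT-subSucc-wkT x) (subT-subSucc-wkT y)

  HExt-R₃ : ∀ {Γ Δ} (x : Tm Γ σ) (y : Tm Γ (ι ⇒ σ ⇒ σ)) (n : Tm Γ ι) →
    Γ ∣ Δ ⊢ HExt σ x ⊃ HExt (ι ⇒ σ ⇒ σ) y ⊃ HExt σ (ℝ · x · y · n)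
  HExt-R₃ x y n = ⊃I (⊃I (cast (φ[ n ]) (∀E (⊢ind φ base-case step-case) n)))
    where
    X = wkT x
    Y = wkT y
    φ = HExt σ (ℝ · X · Y · v₀)
    φ[_] : ∀ m → φ [ m ] ≡ HExt σ (ℝ · x · y · m)
    φ[ m ] = trans (subF-HExt (sub0 m) σ _) (cong (HExt σ) (subT-sub0-R x y m))
    φ[S] : subF subSucc φ ≡ HExt σ (ℝ · X · Y · 𝕊 v₀)
    φ[S] = trans (subF-HExt subSucc σ _) (cong (HExt σ) (subT-subSucc-R x y))
    base-case = cast (sym φ[ 𝟘 ]) (HExt-expand (ax (ax-R0 x y)) (h 1))
    step-case = cast (sym φ[S]) (HExt-expand (ax (ax-RS X Y v₀))
      (HExt-app σ σ (Y · v₀) (ℝ · X · Y · v₀)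
        ! (HExt-app ι (σ ⇒ σ) Y v₀ ! wk-HExt _ y (h 1) ! ⊢refl 𝟘) ! (h 0)))

  HEq-R₂ : ∀ {Γ Δ} (x x' : Tm Γ σ) (y y' : Tm Γ (ι ⇒ σ ⇒ σ)) →
    Γ ∣ Δ ⊢ HExt σ x ⊃ HExt σ x' ⊃ HEq σ x x' ⊃
            HExt (ι ⇒ σ ⇒ σ) y ⊃ HExt (ι ⇒ σ ⇒ σ) y' ⊃ HEq (ι ⇒ σ ⇒ σ) y y' ⊃
            HEq (ι ⇒ σ) (ℝ · x · y) (ℝ · x' · y')
  HEq-R₂ x x' y y' = ⊃I (⊃I (⊃I (⊃I (⊃I (⊃I (⊢ind φ base-case step-case))))))
    where
    X = wkT x
    X' = wkT x'
    Y = wkT y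
    Y' = wkT y'
    Rn = ℝ · X · Y · v₀
    R'n = ℝ · X' · Y' · v₀
    -- The trivial guard makes ∀' ι φ literally HEq (ι ⇒ σ) (ℝ · x · y) (ℝ · x' · y').
    φ = HExt ι v₀ ⊃ HEq σ Rn R'n
    φ[𝟘] : φ [ 𝟘 ] ≡ (HExt ι 𝟘 ⊃ HEq σ (ℝ · x · y · 𝟘) (ℝ · x' · y' · 𝟘))
    φ[𝟘] = cong (HExt ι 𝟘 ⊃_) (trans (subF-HEq (sub0 𝟘) σ Rn R'n)
                                      (cong₂ (HEq σ) (subT-sub0-R x y 𝟘) (subT-sub0-R x' y' 𝟘)))
    φ[S] : subF subSucc φ ≡ (HExt ι (𝕊 v₀) ⊃ HEq σ (ℝ · X · Y · 𝕊 v₀) (ℝ · X' · Y' · 𝕊 v₀))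
    φ[S] = cong (HExt ι (𝕊 v₀) ⊃_) (trans (subF-HEq subSucc σ Rn R'n)
                                           (cong₂ (HEq σ) (subT-subSucc-R x y) (subT-subSucc-R x' y')))
    ERn = HExt-R₃ X Y v₀ ! wk-HExt σ x (h 7) ! wk-HExt _ y (h 4)
    ER'n = HExt-R₃ X' Y' v₀ ! wk-HExt σ x' (h 6) ! wk-HExt _ y' (h 3)
    base-case = cast (sym φ[𝟘]) (⊃I (HEq-expand (ax (ax-R0 x y)) (ax (ax-R0 x' y')) (h 4)))
    vary-argument = ∧E₂ (HExt-⇒-elim (HExt-app ι (σ ⇒ σ) Y v₀ ! wk-HExt _ y (h 4) ! (h 0)) Rn R'n
                          ! ERn ! ER'n ! ((h 1) ! (h 0)))
    vary-function = HEq-⇒-elim (HEq-⇒-elim (wk-HEq _ y y' (h 2)) v₀ ! (h 0)) R'n ! ER'n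
    step-case = cast (sym φ[S]) (⊃I (HEq-expand (ax (ax-RS X Y v₀)) (ax (ax-RS X' Y' v₀))
      (HEq-trans σ (Y · v₀ · Rn) (Y · v₀ · R'n) (Y' · v₀ · R'n) ! vary-argument ! vary-function)))

  HExt-R₂ : ∀ {Γ Δ} (x : Tm Γ σ) (y : Tm Γ (ι ⇒ σ ⇒ σ)) →
    Γ ∣ Δ ⊢ HExt σ x ⊃ HExt (ι ⇒ σ ⇒ σ) y ⊃ HExt (ι ⇒ σ) (ℝ · x · y)
  HExt-R₂ x y = ⊃I (⊃I (HExt-⇒-intro (ℝ · x · y) ERa
    (HEq-expand (⊢refl (ℝ · X · Y · v₁)) (⊢appʳ (ℝ · X · Y) (⊢sym (h 0)))
      (HEq-refl σ _ ! ERa))))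
    where
    X = wkT (wkT x)
    Y = wkT (wkT y)
    ERa = HExt-R₃ X Y v₁ ! wk²-HExt σ x (h 4) ! wk²-HExt _ y (h 3)

  HExt-R₁ : ∀ {Γ Δ} (x : Tm Γ σ) → Γ ∣ Δ ⊢ HExt σ x ⊃ HExt ((ι ⇒ σ ⇒ σ) ⇒ ι ⇒ σ) (ℝ · x)
  HExt-R₁ x = ⊃I (HExt-⇒-intro (ℝ · x)
    (HExt-R₂ X v₁ ! Ex ! (h 2))
    (HEq-R₂ X X v₁ v₀ ! Ex ! Ex ! (HEq-refl σ X ! Ex) ! (h 2) ! (h 1) ! (h 0)))
    where
    X = wkT (wkT x)
    Ex = wk²-HExt σ x (h 3)

  HExt-R : ∀ {Γ Δ} → Γ ∣ Δ ⊢ HExt (σ ⇒ (ι ⇒ σ ⇒ σ) ⇒ ι ⇒ σ) (con (recc σ))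
  HExt-R = HExt-⇒-intro ℝ (HExt-R₁ v₁ ! (h 2)) (HEq-⇒-intro (ℝ · v₁) (ℝ · v₀)
    (HEq-R₂ (wkT v₁) (wkT v₀) v₀ v₀
      ! wk-HExt σ v₁ (h 3) ! wk-HExt σ v₀ (h 2) ! wk-HEq σ v₁ v₀ (h 1)
      ! (h 0) ! (h 0) ! (HEq-refl _ v₀ ! (h 0))))

HExt-con : ∀ {Γ Δ σ} (c : Const σ) → Γ ∣ Δ ⊢ HExt σ (con c)
HExt-con (kc ρ σ)    = HExt-k ρ σ
HExt-con (sc ρ σ τ)  = HExt-s
HExt-con (pairc σ τ) = HExt-pair σ τ
HExt-con (fstc σ τ)  = HExt-fst σ τ
HExt-con (sndc σ τ)  = HExt-snd σ τ
HExt-con zeroc       = ⊢refl 𝟘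
HExt-con succc       = HExt-succ
HExt-con (recc σ)    = HExt-R

HExt-forms : EForms
HExt-forms σ = HExt σ v₀

HEq-forms : QForms
HEq-forms σ = HEq σ v₀ v₁

infix 10 _ᴵ
_ᴵ : ∀ {L Γ} → Form L Γ → Form base Γ
_ᴵ = interp HExt-forms HEq-forms

Extᴵ : ∀ {Γ σ} (t : Tm Γ σ) → Ext t ᴵ ≡ HExt σ t
Extᴵ {σ = σ} t = subF-HExt (sub1 t) σ v₀

=ₑᴵ : ∀ {Γ σ} (x y : Tm Γ σ) → (x =ₑ y) ᴵ ≡ HEq σ x y
=ₑᴵ {σ = σ} x y = subF-HEq (sub2 x y) σ v₀ v₁

subFᴵ : ∀ {L Γ Δ} (s : Sub Γ Δ) (φ : Form L Γ) → subF s φ ᴵ ≡ subF s (φ ᴵ)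
subFᴵ s ⊥'                 = refl
subFᴵ s (t ≡' u)           = refl
subFᴵ s (Ext {σ = σ} t)    =
  trans (Extᴵ (subT s t)) (sym (trans (cong (subF s) (Extᴵ t)) (subF-HExt s σ t)))
subFᴵ s (_=ₑ_ {σ = σ} t u) =
  trans (=ₑᴵ (subT s t) (subT s u)) (sym (trans (cong (subF s) (=ₑᴵ t u)) (subF-HEq s σ t u)))
subFᴵ s (φ ∧' ψ)           = cong₂ _∧'_ (subFᴵ s φ) (subFᴵ s ψ)
subFᴵ s (φ ∨' ψ)           = cong₂ _∨'_ (subFᴵ s φ) (subFᴵ s ψ)
subFᴵ s (φ ⊃ ψ)            = cong₂ _⊃_ (subFᴵ s φ) (subFᴵ s ψ)
subFᴵ s (∀' σ φ)           = cong (∀' σ) (subFᴵ (liftS s) φ)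
subFᴵ s (∃' σ φ)           = cong (∃' σ) (subFᴵ (liftS s) φ)

map-wkFᴵ : ∀ {L Γ τ} (Δ : List (Form L Γ)) → map _ᴵ (map (wkF {τ = τ}) Δ) ≡ map wkF (map _ᴵ Δ)
map-wkFᴵ []      = refl
map-wkFᴵ (φ ∷ Δ) = cong₂ _∷_ (subFᴵ _ φ) (map-wkFᴵ Δ)

embedᴵ : ∀ {Γ} (φ : Form base Γ) → embed φ ᴵ ≡ φ
embedᴵ ⊥'       = refl
embedᴵ (t ≡' u) = refl
embedᴵ (φ ∧' ψ) = cong₂ _∧'_ (embedᴵ φ) (embedᴵ ψ)
embedᴵ (φ ∨' ψ) = cong₂ _∨'_ (embedᴵ φ) (embedᴵ ψ)
embedᴵ (φ ⊃ ψ)  = cong₂ _⊃_ (embedᴵ φ) (embedᴵ ψ)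
embedᴵ (∀' σ φ) = cong (∀' σ) (embedᴵ φ)
embedᴵ (∃' σ φ) = cong (∃' σ) (embedᴵ φ)

⊢⇔'-reflexive : ∀ {Γ Δ} {φ ψ : Form base Γ} → φ ≡ ψ → Γ ∣ Δ ⊢ φ ⇔' ψ
⊢⇔'-reflexive refl = ∧I (⊃I (h 0)) (⊃I (h 0))

AxBaseᴵ : ∀ {Γ Δ} {φ : Form ext Γ} → AxBase φ → Γ ∣ Δ ⊢ φ ᴵ
AxBaseᴵ (≡-refl x)        = ax (≡-refl x)
AxBaseᴵ (≡-sym x y)       = ax (≡-sym x y)
AxBaseᴵ (≡-trans x y z)   = ax (≡-trans x y z)
AxBaseᴵ (≡-app x x' y y') = ax (≡-app x x' y y')
AxBaseᴵ (ax-k x y)        = ax (ax-k x y)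
AxBaseᴵ (ax-s x y z)      = ax (ax-s x y z)
AxBaseᴵ (ax-fst x y)      = ax (ax-fst x y)
AxBaseᴵ (ax-snd x y)      = ax (ax-snd x y)
AxBaseᴵ (ax-R0 x y)       = ax (ax-R0 x y)
AxBaseᴵ (ax-RS x y m)     = ax (ax-RS x y m)
AxBaseᴵ (S-inj x y)       = ax (S-inj x y)
AxBaseᴵ (S≢0 x)           = ax (S≢0 x)
AxBaseᴵ (ind φ)           = cast (sym (cong₂ _⊃_ (subFᴵ (sub0 𝟘) φ)
  (cong (λ φₛ → ∀' ι (φ ᴵ ⊃ φₛ) ⊃ ∀' ι (φ ᴵ)) (subFᴵ subSucc φ)))) (ax (ind (φ ᴵ)))

AxHᴵ : ∀ {Γ Δ} {φ : Form ext Γ} → AxH φ → Γ ∣ Δ ⊢ φ ᴵ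
AxHᴵ (eq-0 x y)            = ⊢⇔'-reflexive (=ₑᴵ x y)
AxHᴵ (ext-0 x)             = cast (sym (Extᴵ x)) (⊢refl 𝟘)
AxHᴵ (eq-× x y)            = ⊢⇔'-reflexive (trans (=ₑᴵ x y)
  (sym (cong₂ _∧'_ (=ₑᴵ (fst · x) (fst · y)) (=ₑᴵ (snd · x) (snd · y)))))
AxHᴵ (ext-× x)             = ⊢⇔'-reflexive (trans (Extᴵ x)
  (sym (cong₂ _∧'_ (Extᴵ (fst · x)) (Extᴵ (snd · x)))))
AxHᴵ (eq-→ f g)            = ⊢⇔'-reflexive (trans (=ₑᴵ f g)
  (sym (cong (∀' _) (cong₂ _⊃_ (Extᴵ v₀) (=ₑᴵ (wkT f · v₀) (wkT g · v₀))))))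
AxHᴵ (ext-app {σ} {τ} f x) =
  cast (sym (cong₂ _⊃_ (Extᴵ f) (cong₂ _⊃_ (Extᴵ x) (Extᴵ (f · x))))) (HExt-app σ τ f x)
AxHᴵ (ext-≡ {σ} x y)       =
  cast (sym (cong (x ≡' y ⊃_) (cong₂ _⊃_ (Extᴵ x) (Extᴵ y)))) (HExt-resp-≡ σ x y)
AxHᴵ (ext-con c)           = cast (sym (Extᴵ (con c))) (HExt-con c)

AxEᴵ : ∀ {Γ Δ} {φ : Form ext Γ} → AxE φ → Γ ∣ Δ ⊢ φ ᴵ
AxEᴵ (extensionality {σ} {τ} f x y) = cast (sym (cong₂ _⊃_ (Extᴵ f) (cong₂ _⊃_ (Extᴵ x)
  (cong₂ _⊃_ (Extᴵ y) (cong₂ _⊃_ (=ₑᴵ x y) (=ₑᴵ (f · x) (f · y)))))))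
  (HExt-extensional σ τ f x y)

HE⇒HAᴵ : ∀ {Γ Δ φ} → Der HE-Ax Γ Δ φ → Γ ∣ map _ᴵ Δ ⊢ φ ᴵ
HE⇒HAᴵ (ax (inj₁ a))        = AxBaseᴵ a
HE⇒HAᴵ (ax (inj₂ (inj₁ a))) = AxHᴵ a
HE⇒HAᴵ (ax (inj₂ (inj₂ a))) = AxEᴵ a
HE⇒HAᴵ (hyp p)              = hyp (∈-map⁺ _ᴵ p)
HE⇒HAᴵ (⊥E d)               = ⊥E (HE⇒HAᴵ d)
HE⇒HAᴵ (∧I d e)             = ∧I (HE⇒HAᴵ d) (HE⇒HAᴵ e)
HE⇒HAᴵ (∧E₁ d)              = ∧E₁ (HE⇒HAᴵ d)
HE⇒HAᴵ (∧E₂ d)              = ∧E₂ (HE⇒HAᴵ d)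
HE⇒HAᴵ (∨I₁ d)              = ∨I₁ (HE⇒HAᴵ d)
HE⇒HAᴵ (∨I₂ d)              = ∨I₂ (HE⇒HAᴵ d)
HE⇒HAᴵ (∨E d e f)           = ∨E (HE⇒HAᴵ d) (HE⇒HAᴵ e) (HE⇒HAᴵ f)
HE⇒HAᴵ (⊃I d)               = ⊃I (HE⇒HAᴵ d)
HE⇒HAᴵ (⊃E d e)             = ⊃E (HE⇒HAᴵ d) (HE⇒HAᴵ e)
HE⇒HAᴵ (∀I {Γ} {Δ} {σ} {φ} d) = ∀I (subst (λ Θ → σ ∷ Γ ∣ Θ ⊢ φ ᴵ) (map-wkFᴵ Δ) (HE⇒HAᴵ d))
HE⇒HAᴵ (∀E {φ = φ} d t)     = cast (sym (subFᴵ (sub0 t) φ)) (∀E (HE⇒HAᴵ d) t)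
HE⇒HAᴵ (∃I {φ = φ} t d)     = ∃I t (cast (subFᴵ (sub0 t) φ) (HE⇒HAᴵ d))
HE⇒HAᴵ (∃E {Γ} {Δ} {σ} {φ} {ψ} d e) = ∃E (HE⇒HAᴵ d)
  (cast (subFᴵ _ ψ) (subst (λ Θ → σ ∷ Γ ∣ φ ᴵ ∷ Θ ⊢ wkF ψ ᴵ) (map-wkFᴵ Δ) (HE⇒HAᴵ e)))

theorem4p3 : Σ EForms λ E → Σ QForms λ Q →
    ((∀ {Γ} (φ : Form ext Γ) → Γ ⊢HE φ → Γ ⊢HA interp E Q φ)
    × (∀ {Γ} (φ : Form base Γ) → Γ ⊢HE embed φ → Γ ⊢HA φ))
theorem4p3 = HExt-forms , HEq-forms , (λ φ → HE⇒HAᴵ) , (λ φ d → cast (embedᴵ φ) (HE⇒HAᴵ d))
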